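{- Let $L_2$ be the graph with vertex set $\{a,b,c,x,y\}$ and edge set $\{(a,b),(a,c),(b,c),(a,x),(c,x),(b,y),(c,y)\}$. Let $\theta$ be any rectangle representation of $L_2$. Then $\theta(c)\cap(\theta(a)-\theta(b))\neq\emptyset$ and $\theta(c)\cap(\theta(b)-\theta(a))\neq\emptyset$.
   Context: A rectangle representation of a graph $G$ is a map $\theta$ assigning to each vertex $v$ an axis-parallel rectangle $\theta(v)=\Pi_1(v)\times\Pi_2(v)\subseteq\mathbb{R}^2$, where $\Pi_1(v),\Pi_2(v)$ are closed intervals of the real line, such that for distinct vertices $u,v$, $(u,v)$ is an edge of $G$ if and only if $\theta(u)\cap\theta(v)\neq\emptyset$. Here $-$ denotes set difference. -}

module Defs where

open import Level using (Level; _⊔_)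
open import Data.Product using (Σ; _×_; _,_; ∃-syntax)
open import Relation.Nullary using (¬_)
open import Relation.Binary.PropositionalEquality using (_≡_)
open import Relation.Binary.Bundles using (TotalOrder)

data V : Set where
  a b c x y : V

data E : V → V → Set where
  ab : E a b
  ac : E a c
  bc : E b c
  ax : E a x
  cx : E c x
  by : E b y
  cy : E c y

data Adj (u v : V) : Set where
  fwd : E u v → Adj u v
  bwd : E v u → Adj u v

-- Geometry over an arbitrary total order (the real line ℝ is an instance;
-- Agda's stdlib has no reals).
module Geometry {c ℓ₁ ℓ₂ : Level} (O : TotalOrder c ℓ₁ ℓ₂) where
  open TotalOrder O renaming (Carrier to R)

  record Interval : Set (c ⊔ ℓ₂) where
    constructor [_,_]⟨_⟩
    field
      lo : R
      hi : R
      lo≤hi : lo ≤ hi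

  _∈ᵢ_ : R → Interval → Set ℓ₂
  p ∈ᵢ I = (Interval.lo I ≤ p) × (p ≤ Interval.hi I)

  record Rect : Set (c ⊔ ℓ₂) where
    constructor _⊠_
    field
      Π₁ : Interval
      Π₂ : Interval

  Point : Set c
  Point = R × R

  _∈_ : Point → Rect → Set ℓ₂
  (p₁ , p₂) ∈ r = (p₁ ∈ᵢ Rect.Π₁ r) × (p₂ ∈ᵢ Rect.Π₂ r)

  Meets : Rect → Rect → Set (c ⊔ ℓ₂)
  Meets r s = ∃[ p ] (p ∈ r × p ∈ s)

  record RectRep (θ : V → Rect) : Set (c ⊔ ℓ₂) where
    field
      edge→meet : ∀ u v → ¬ (u ≡ v) → Adj u v → Meets (θ u) (θ v)
      meet→edge : ∀ u v → ¬ (u ≡ v) → Meets (θ u) (θ v) → Adj u v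

  MeetsDiff : Rect → Rect → Rect → Set (c ⊔ ℓ₂)
  MeetsDiff r s t = ∃[ p ] (p ∈ r × (p ∈ s × ¬ (p ∈ t)))

{-# OPTIONS --safe #-}
-- Axis-parallel rectangles have the Helly property: three pairwise
-- intersecting rectangles share a point. Coordinatewise this is Helly for
-- intervals, where the largest left endpoint lies in all three intervals.
-- In L₂ the triangle x, a, c therefore has a common point; it lies in
-- θ(c) ∩ θ(a), and not in θ(b) because x and b are not adjacent.
-- The triangle y, b, c gives the other half in the same way.
module Submission where

open import Defs
open import Level using (Level)
open import Data.Product using (_×_; _,_; ∃-syntax)
open import Relation.Binary.Bundles using (TotalOrder)
open import Relation.Binary.PropositionalEquality using (_≢_; refl)
open import Relation.Nullary using (¬_)

E-irrefl : ∀ {u} → ¬ E u u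
E-irrefl ()

Adj-irrefl : ∀ {u v} → Adj u v → u ≢ v
Adj-irrefl (fwd e) refl = E-irrefl e
Adj-irrefl (bwd e) refl = E-irrefl e

module _ {ℓ₀ ℓ₁ ℓ₂ : Level} (O : TotalOrder ℓ₀ ℓ₁ ℓ₂) where
  open TotalOrder O using (_≤_; trans) renaming (Carrier to R)
  open import Algebra.Construct.NaturalChoice.Max O using (_⊔_; x≤x⊔y; x≤y⊔x; x≤y⇒x≤y⊔z; ⊔-lub)
  open Geometry O
  open Interval
  open Rect

  Overlapsᵢ : Interval → Interval → Set ℓ₂
  Overlapsᵢ I J = (lo I ≤ hi J) × (lo J ≤ hi I)

  ∈ᵢ-both⇒overlapsᵢ : ∀ {p} I J → p ∈ᵢ I → p ∈ᵢ J → Overlapsᵢ I J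
  ∈ᵢ-both⇒overlapsᵢ _ _ (lo≤p , p≤hi) (lo≤p′ , p≤hi′) = trans lo≤p p≤hi′ , trans lo≤p′ p≤hi

  helly-Interval : ∀ I J K → Overlapsᵢ I J → Overlapsᵢ I K → Overlapsᵢ J K →
                   ∃[ p ] (p ∈ᵢ I × p ∈ᵢ J × p ∈ᵢ K)
  helly-Interval I J K (IJ , JI) (IK , KI) (JK , KJ) =
    m , (loI≤m , m≤hi (lo≤hi I) JI KI)
      , (loJ≤m , m≤hi IJ (lo≤hi J) KJ)
      , (loK≤m , m≤hi IK JK (lo≤hi K))
    where
      m : R
      m = lo I ⊔ lo J ⊔ lo K

      loI≤m : lo I ≤ m
      loI≤m = x≤y⇒x≤y⊔z (lo K) (x≤x⊔y (lo I) (lo J))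

      loJ≤m : lo J ≤ m
      loJ≤m = x≤y⇒x≤y⊔z (lo K) (x≤y⊔x (lo I) (lo J))

      loK≤m : lo K ≤ m
      loK≤m = x≤y⊔x (lo I ⊔ lo J) (lo K)

      m≤hi : ∀ {h} → lo I ≤ h → lo J ≤ h → lo K ≤ h → m ≤ h
      m≤hi I≤h J≤h K≤h = ⊔-lub (⊔-lub I≤h J≤h) K≤h

  Meets⇒overlaps : ∀ r s → Meets r s → Overlapsᵢ (Π₁ r) (Π₁ s) × Overlapsᵢ (Π₂ r) (Π₂ s)
  Meets⇒overlaps r s (_ , (r₁ , r₂) , (s₁ , s₂)) =
    ∈ᵢ-both⇒overlapsᵢ (Π₁ r) (Π₁ s) r₁ s₁ , ∈ᵢ-both⇒overlapsᵢ (Π₂ r) (Π₂ s) r₂ s₂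

  helly-Rect : ∀ r s t → Meets r s → Meets r t → Meets s t →
               ∃[ p ] (p ∈ r × p ∈ s × p ∈ t)
  helly-Rect r s t rs rt st
    with Meets⇒overlaps r s rs | Meets⇒overlaps r t rt | Meets⇒overlaps s t st
  ... | rs₁ , rs₂ | rt₁ , rt₂ | st₁ , st₂
    with helly-Interval (Π₁ r) (Π₁ s) (Π₁ t) rs₁ rt₁ st₁
       | helly-Interval (Π₂ r) (Π₂ s) (Π₂ t) rs₂ rt₂ st₂
  ... | p₁ , r₁ , s₁ , t₁ | p₂ , r₂ , s₂ , t₂ = (p₁ , p₂) , (r₁ , r₂) , (s₁ , s₂) , (t₁ , t₂)

  module _ {θ : V → Rect} (rep : RectRep θ) where
    open RectRep rep

    Adj⇒Meets : ∀ {u v} → Adj u v → Meets (θ u) (θ v)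
    Adj⇒Meets uv = edge→meet _ _ (Adj-irrefl uv) uv

    triangle⇒MeetsDiff : ∀ {u v w z} → Adj u v → Adj u w → Adj v w →
                         u ≢ z → ¬ Adj u z → MeetsDiff (θ v) (θ w) (θ z)
    triangle⇒MeetsDiff uv uw vw u≢z ¬uz
      with helly-Rect (θ _) (θ _) (θ _) (Adj⇒Meets uv) (Adj⇒Meets uw) (Adj⇒Meets vw)
    ... | p , p∈u , p∈v , p∈w = p , p∈v , p∈w , λ p∈z → ¬uz (meet→edge _ _ u≢z (p , p∈u , p∈z))

lemma3 : {ℓ₀ ℓ₁ ℓ₂ : Level} (O : TotalOrder ℓ₀ ℓ₁ ℓ₂) (θ : V → Geometry.Rect O) →
         Geometry.RectRep O θ →
         Geometry.MeetsDiff O (θ c) (θ a) (θ b) × Geometry.MeetsDiff O (θ c) (θ b) (θ a)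
lemma3 O θ rep =
  triangle⇒MeetsDiff O rep (bwd cx) (bwd ax) (bwd ac) (λ ()) (λ { (fwd ()) ; (bwd ()) }) ,
  triangle⇒MeetsDiff O rep (bwd cy) (bwd by) (bwd bc) (λ ()) (λ { (fwd ()) ; (bwd ()) })
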